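{- For $n=2$, the logic obtained by adding to $\mathrm{S5}_2$ all instances of the schema (WD) $\left(S\varphi_1\wedge S\varphi_2\right)\to SS(\varphi_1\wedge\varphi_2)$, with $\varphi_1$ 1-local and $\varphi_2$ 2-local, has exactly the same theorems as the logic obtained by adding to $\mathrm{S5}_2$ the axiom $\Diamond_1\Box_2p\to\Box_2\Diamond_1p$ (closed under uniform substitution); i.e. each axiom is derivable in $\mathrm{S5}_2$ extended by the other.
   Context: $\mathcal{L}_2$: $\varphi::=p\mid\neg\varphi\mid\varphi\wedge\varphi\mid\Box_1\varphi\mid\Box_2\varphi$, $\Diamond_i=\neg\Box_i\neg$, $S\varphi:=\Diamond_1\varphi\vee\Diamond_2\varphi$. A formula is $i$-local if it is a Boolean combination of formulae $\Box_i\psi$. $\mathrm{S5}_2$: propositional tautologies; for $i=1,2$ the axioms $\Box_i(p\to q)\to(\Box_ip\to\Box_iq)$, $\Box_ip\to p$, $\Box_ip\to\Box_i\Box_ip$, $\neg\Box_i\neg p\to\Box_i\neg\Box_i\neg p$; rules modus ponens, necessitation, uniform substitution. -}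

module Defs where

open import Data.Nat using (ℕ)
open import Data.Bool using (Bool; true; false; not; _∧_)
open import Relation.Binary.PropositionalEquality using (_≡_)

data Ag : Set where
  a₁ a₂ : Ag

infix 9 ¬'_
infixr 7 _∧'_
infixr 6 _∨'_
infixr 5 _⇒_
data Fm : Set where
  var  : ℕ → Fm
  ¬'_  : Fm → Fm
  _∧'_ : Fm → Fm → Fm
  □    : Ag → Fm → Fm

_∨'_ : Fm → Fm → Fm
φ ∨' ψ = ¬' ((¬' φ) ∧' (¬' ψ))

_⇒_ : Fm → Fm → Fm
φ ⇒ ψ = ¬' (φ ∧' (¬' ψ))

◇ : Ag → Fm → Fm
◇ i φ = ¬' (□ i (¬' φ))

S : Fm → Fm
S φ = ◇ a₁ φ ∨' ◇ a₂ φ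

data Local (i : Ag) : Fm → Set where
  box : ∀ ψ → Local i (□ i ψ)
  neg : ∀ {φ} → Local i φ → Local i (¬' φ)
  conj : ∀ {φ ψ} → Local i φ → Local i ψ → Local i (φ ∧' ψ)

subst : (ℕ → Fm) → Fm → Fm
subst σ (var n) = σ n
subst σ (¬' φ) = ¬' (subst σ φ)
subst σ (φ ∧' ψ) = subst σ φ ∧' subst σ ψ
subst σ (□ i φ) = □ i (subst σ φ)

-- Propositional tautologies: true under every Boolean valuation that
-- treats variables and modal subformulas □ᵢ ψ as atoms.
evalP : (ℕ → Bool) → (Ag → Fm → Bool) → Fm → Bool
evalP v w (var n) = v n
evalP v w (¬' φ) = not (evalP v w φ)
evalP v w (φ ∧' ψ) = evalP v w φ ∧ evalP v w ψ
evalP v w (□ i φ) = w i φ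

Tautology : Fm → Set
Tautology φ = ∀ (v : ℕ → Bool) (w : Ag → Fm → Bool) → evalP v w φ ≡ true

p q : Fm
p = var 0
q = var 1

data S5₂⊕ (Ax : Fm → Set) : Fm → Set where
  taut : ∀ {φ} → Tautology φ → S5₂⊕ Ax φ
  axK  : ∀ i → S5₂⊕ Ax (□ i (p ⇒ q) ⇒ (□ i p ⇒ □ i q))
  axT  : ∀ i → S5₂⊕ Ax (□ i p ⇒ p)
  ax4  : ∀ i → S5₂⊕ Ax (□ i p ⇒ □ i (□ i p))
  ax5  : ∀ i → S5₂⊕ Ax (¬' (□ i (¬' p)) ⇒ □ i (¬' (□ i (¬' p))))
  extra : ∀ {φ} → Ax φ → S5₂⊕ Ax φ
  mp   : ∀ {φ ψ} → S5₂⊕ Ax (φ ⇒ ψ) → S5₂⊕ Ax φ → S5₂⊕ Ax ψ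
  nec  : ∀ {φ} i → S5₂⊕ Ax φ → S5₂⊕ Ax (□ i φ)
  usub : ∀ {φ} (σ : ℕ → Fm) → S5₂⊕ Ax φ → S5₂⊕ Ax (subst σ φ)

data WD : Fm → Set where
  wd : ∀ {φ₁ φ₂} → Local a₁ φ₁ → Local a₂ φ₂ →
       WD ((S φ₁ ∧' S φ₂) ⇒ S (S (φ₁ ∧' φ₂)))

data Comm : Fm → Set where
  comm : Comm (◇ a₁ (□ a₂ p) ⇒ □ a₂ (◇ a₁ p))

{-# OPTIONS --safe #-}
module Submission where

-- An i-local formula φ satisfies φ → □ᵢφ and ◇ᵢφ → φ in S5₂.
-- (WD) ⊢ Comm: with φ₁ = □₁¬p and φ₂ = □₂p, the conjunction φ₁ ∧ φ₂ is refuted by T,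
-- so (WD) refutes Sφ₁ ∧ Sφ₂, in particular ◇₂□₁¬p ∧ ◇₁□₂p; this is ¬(¬□₂◇₁p ∧ ◇₁□₂p).
-- Comm ⊢ (WD): by locality Sφ₁ ∧ Sφ₂ splits into (φ₁ ∨ ◇₂φ₁) ∧ (◇₁φ₂ ∨ φ₂), and each case
-- gives ◇ᵢ(φ₁ ∧ φ₂) or φ₁ ∧ φ₂ by pulling a local conjunct under a diamond. The exception
-- is ◇₂φ₁ ∧ ◇₁φ₂: there ◇₁φ₂ → ◇₁□₂φ₂ → □₂◇₁φ₂ by Comm, which yields ◇₂(φ₁ ∧ ◇₁φ₂),
-- and that implies ◇₂◇₁(φ₁ ∧ φ₂).
-- Propositional steps are instances of Boolean schemata whose validity is decided by evaluation.

open import Defs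
open import Data.Bool using (Bool; true; false; not; _∧_)
open import Data.Bool.Properties using () renaming (_≟_ to _≟ᵇ_)
open import Data.Fin using (Fin; #_)
open import Data.Nat using (ℕ; zero; suc)
open import Data.Nat.Properties using () renaming (_≤?_ to _≤ℕ?_)
open import Data.Product using (_×_; _,_)
open import Data.Vec using (Vec; []; _∷_; lookup; map)
open import Data.Vec.Properties using (lookup-map)
open import Function using (_∘_)
open import Relation.Binary.PropositionalEquality using (_≡_; cong; cong₂; sym; trans)
open import Relation.Nullary.Decidable using (Dec; True; toWitness; map′; _×-dec_)

infix 4 _⊢_
_⊢_ : (Fm → Set) → Fm → Set
Ax ⊢ φ = S5₂⊕ Ax φ

cut-axioms : ∀ {Ax Ax′} → (∀ {φ} → Ax φ → Ax′ ⊢ φ) → ∀ {φ} → Ax ⊢ φ → Ax′ ⊢ φ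
cut-axioms h (taut t) = taut t
cut-axioms h (axK i) = axK i
cut-axioms h (axT i) = axT i
cut-axioms h (ax4 i) = ax4 i
cut-axioms h (ax5 i) = ax5 i
cut-axioms h (extra a) = h a
cut-axioms h (mp d e) = mp (cut-axioms h d) (cut-axioms h e)
cut-axioms h (nec i d) = nec i (cut-axioms h d)
cut-axioms h (usub σ d) = usub σ (cut-axioms h d)

infix 9 ¬ₛ_
infixr 7 _∧ₛ_
infixr 6 _∨ₛ_
infixr 5 _⇒ₛ_
data Schema (n : ℕ) : Set where
  atom : Fin n → Schema n
  ¬ₛ_  : Schema n → Schema n
  _∧ₛ_ : Schema n → Schema n → Schema n

_∨ₛ_ : ∀ {n} → Schema n → Schema n → Schema n
s ∨ₛ t = ¬ₛ (¬ₛ s ∧ₛ ¬ₛ t)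

_⇒ₛ_ : ∀ {n} → Schema n → Schema n → Schema n
s ⇒ₛ t = ¬ₛ (s ∧ₛ ¬ₛ t)

x : ∀ m {n} {m<n : True (suc m ≤ℕ? n)} → Schema n
x m {m<n = m<n} = atom ((# m) {m<n = m<n})

instantiate : ∀ {n} → Vec Fm n → Schema n → Fm
instantiate ρ (atom k) = lookup ρ k
instantiate ρ (¬ₛ s) = ¬' instantiate ρ s
instantiate ρ (s ∧ₛ t) = instantiate ρ s ∧' instantiate ρ t

eval : ∀ {n} → Vec Bool n → Schema n → Bool
eval v (atom k) = lookup v k
eval v (¬ₛ s) = not (eval v s)
eval v (s ∧ₛ t) = eval v s ∧ eval v t

Valid : ∀ {n} → Schema n → Set
Valid s = ∀ v → eval v s ≡ true

∀-valuation? : ∀ {n} {P : Vec Bool n → Set} → (∀ v → Dec (P v)) → Dec (∀ v → P v)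
∀-valuation? {zero} P? = map′ (λ { p [] → p }) (λ h → h []) (P? [])
∀-valuation? {suc n} P? =
  map′ (λ { (t , f) (true ∷ v) → t v ; (t , f) (false ∷ v) → f v })
       (λ h → h ∘ (true ∷_) , h ∘ (false ∷_))
       (∀-valuation? (P? ∘ (true ∷_)) ×-dec ∀-valuation? (P? ∘ (false ∷_)))

valid? : ∀ {n} (s : Schema n) → Dec (Valid s)
valid? s = ∀-valuation? (λ v → eval v s ≟ᵇ true)

evalP-instantiate : ∀ {n} v w (ρ : Vec Fm n) s →
                    evalP v w (instantiate ρ s) ≡ eval (map (evalP v w) ρ) s
evalP-instantiate v w ρ (atom k) = sym (lookup-map k (evalP v w) ρ)
evalP-instantiate v w ρ (¬ₛ s) = cong not (evalP-instantiate v w ρ s)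
evalP-instantiate v w ρ (s ∧ₛ t) = cong₂ _∧_ (evalP-instantiate v w ρ s) (evalP-instantiate v w ρ t)

module _ {Ax : Fm → Set} where

  tautology : ∀ {n} (ρ : Vec Fm n) (s : Schema n) {valid : True (valid? s)} → Ax ⊢ instantiate ρ s
  tautology ρ s {valid} = taut λ v w →
    trans (evalP-instantiate v w ρ s) (toWitness valid (map (evalP v w) ρ))

  mp₂ : ∀ {A B C} → Ax ⊢ A ⇒ B ⇒ C → Ax ⊢ A → Ax ⊢ B → Ax ⊢ C
  mp₂ d a b = mp (mp d a) b

  ⇒-refl : ∀ {A} → Ax ⊢ A ⇒ A
  ⇒-refl {A} = tautology (A ∷ []) (x 0 ⇒ₛ x 0)

  ⇒-trans : ∀ {A B C} → Ax ⊢ A ⇒ B → Ax ⊢ B ⇒ C → Ax ⊢ A ⇒ C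
  ⇒-trans {A} {B} {C} = mp₂ (tautology (A ∷ B ∷ C ∷ []) ((x 0 ⇒ₛ x 1) ⇒ₛ (x 1 ⇒ₛ x 2) ⇒ₛ x 0 ⇒ₛ x 2))

  ⇒-contrapose : ∀ {A B} → Ax ⊢ (A ⇒ B) ⇒ (¬' B ⇒ ¬' A)
  ⇒-contrapose {A} {B} = tautology (A ∷ B ∷ []) ((x 0 ⇒ₛ x 1) ⇒ₛ ¬ₛ x 1 ⇒ₛ ¬ₛ x 0)

  contrapose : ∀ {A B} → Ax ⊢ A ⇒ B → Ax ⊢ ¬' B ⇒ ¬' A
  contrapose = mp ⇒-contrapose

  modus-tollens : ∀ {A B} → Ax ⊢ A ⇒ B → Ax ⊢ ¬' B → Ax ⊢ ¬' A
  modus-tollens d = mp (contrapose d)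

  ⇒-uncurry : ∀ {A B C} → Ax ⊢ A ⇒ B ⇒ C → Ax ⊢ A ∧' B ⇒ C
  ⇒-uncurry {A} {B} {C} = mp (tautology (A ∷ B ∷ C ∷ []) ((x 0 ⇒ₛ x 1 ⇒ₛ x 2) ⇒ₛ x 0 ∧ₛ x 1 ⇒ₛ x 2))

  ¬¬-intro : ∀ {A} → Ax ⊢ A ⇒ ¬' ¬' A
  ¬¬-intro {A} = tautology (A ∷ []) (x 0 ⇒ₛ ¬ₛ ¬ₛ x 0)

  ¬¬-elim : ∀ {A} → Ax ⊢ ¬' ¬' A ⇒ A
  ¬¬-elim {A} = tautology (A ∷ []) (¬ₛ ¬ₛ x 0 ⇒ₛ x 0)

  ¬-contradiction : ∀ {A} → Ax ⊢ ¬' (¬' A ∧' A)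
  ¬-contradiction {A} = tautology (A ∷ []) (¬ₛ (¬ₛ x 0 ∧ₛ x 0))

  ∧-comm : ∀ {A B} → Ax ⊢ A ∧' B ⇒ B ∧' A
  ∧-comm {A} {B} = tautology (A ∷ B ∷ []) (x 0 ∧ₛ x 1 ⇒ₛ x 1 ∧ₛ x 0)

  ∧-pair : ∀ {A B} → Ax ⊢ A ⇒ B ⇒ A ∧' B
  ∧-pair {A} {B} = tautology (A ∷ B ∷ []) (x 0 ⇒ₛ x 1 ⇒ₛ x 0 ∧ₛ x 1)

  ∧-elimˡ : ∀ {A B} → Ax ⊢ A ∧' B ⇒ A
  ∧-elimˡ {A} {B} = tautology (A ∷ B ∷ []) (x 0 ∧ₛ x 1 ⇒ₛ x 0)

  ∧-elimʳ : ∀ {A B} → Ax ⊢ A ∧' B ⇒ B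
  ∧-elimʳ {A} {B} = tautology (A ∷ B ∷ []) (x 0 ∧ₛ x 1 ⇒ₛ x 1)

  ⇒-∧-intro : ∀ {A B C} → Ax ⊢ A ⇒ B → Ax ⊢ A ⇒ C → Ax ⊢ A ⇒ B ∧' C
  ⇒-∧-intro {A} {B} {C} = mp₂ (tautology (A ∷ B ∷ C ∷ []) ((x 0 ⇒ₛ x 1) ⇒ₛ (x 0 ⇒ₛ x 2) ⇒ₛ x 0 ⇒ₛ x 1 ∧ₛ x 2))

  ∧-mono : ∀ {A A′ B B′} → Ax ⊢ A ⇒ A′ → Ax ⊢ B ⇒ B′ → Ax ⊢ A ∧' B ⇒ A′ ∧' B′
  ∧-mono {A} {A′} {B} {B′} = mp₂ (tautology (A ∷ A′ ∷ B ∷ B′ ∷ [])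
    ((x 0 ⇒ₛ x 1) ⇒ₛ (x 2 ⇒ₛ x 3) ⇒ₛ x 0 ∧ₛ x 2 ⇒ₛ x 1 ∧ₛ x 3))

  ∨-mono : ∀ {A A′ B B′} → Ax ⊢ A ⇒ A′ → Ax ⊢ B ⇒ B′ → Ax ⊢ A ∨' B ⇒ A′ ∨' B′
  ∨-mono {A} {A′} {B} {B′} = mp₂ (tautology (A ∷ A′ ∷ B ∷ B′ ∷ [])
    ((x 0 ⇒ₛ x 1) ⇒ₛ (x 2 ⇒ₛ x 3) ⇒ₛ x 0 ∨ₛ x 2 ⇒ₛ x 1 ∨ₛ x 3))

  ∨-introˡ : ∀ {A B} → Ax ⊢ A ⇒ A ∨' B
  ∨-introˡ {A} {B} = tautology (A ∷ B ∷ []) (x 0 ⇒ₛ x 0 ∨ₛ x 1)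

  ∨-introʳ : ∀ {A B} → Ax ⊢ B ⇒ A ∨' B
  ∨-introʳ {A} {B} = tautology (A ∷ B ∷ []) (x 1 ⇒ₛ x 0 ∨ₛ x 1)

  ¬∨-intro : ∀ {A B} → Ax ⊢ ¬' A → Ax ⊢ ¬' B → Ax ⊢ ¬' (A ∨' B)
  ¬∨-intro {A} {B} = mp₂ (tautology (A ∷ B ∷ []) (¬ₛ x 0 ⇒ₛ ¬ₛ x 1 ⇒ₛ ¬ₛ (x 0 ∨ₛ x 1)))

  ∨∧∨-elim : ∀ {A₁ A₂ B₁ B₂ C} →
             Ax ⊢ A₁ ∧' B₁ ⇒ C → Ax ⊢ A₁ ∧' B₂ ⇒ C → Ax ⊢ A₂ ∧' B₁ ⇒ C → Ax ⊢ A₂ ∧' B₂ ⇒ C →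
             Ax ⊢ (A₁ ∨' A₂) ∧' (B₁ ∨' B₂) ⇒ C
  ∨∧∨-elim {A₁} {A₂} {B₁} {B₂} {C} c₁₁ c₁₂ c₂₁ c₂₂ =
    mp (mp (mp (mp (tautology (A₁ ∷ A₂ ∷ B₁ ∷ B₂ ∷ C ∷ [])
      ((x 0 ∧ₛ x 2 ⇒ₛ x 4) ⇒ₛ (x 0 ∧ₛ x 3 ⇒ₛ x 4) ⇒ₛ (x 1 ∧ₛ x 2 ⇒ₛ x 4) ⇒ₛ (x 1 ∧ₛ x 3 ⇒ₛ x 4) ⇒ₛ
       (x 0 ∨ₛ x 1) ∧ₛ (x 2 ∨ₛ x 3) ⇒ₛ x 4)) c₁₁) c₁₂) c₂₁) c₂₂

pq↦ : Fm → Fm → ℕ → Fm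
pq↦ A B zero = A
pq↦ A B (suc zero) = B
pq↦ A B (suc (suc n)) = var (suc (suc n))

module _ {Ax : Fm → Set} where

  □-K : ∀ {i A B} → Ax ⊢ □ i (A ⇒ B) ⇒ □ i A ⇒ □ i B
  □-K {i} {A} {B} = usub (pq↦ A B) (axK i)

  □-T : ∀ {i A} → Ax ⊢ □ i A ⇒ A
  □-T {i} {A} = usub (pq↦ A A) (axT i)

  □-4 : ∀ {i A} → Ax ⊢ □ i A ⇒ □ i (□ i A)
  □-4 {i} {A} = usub (pq↦ A A) (ax4 i)

  ◇-5 : ∀ {i A} → Ax ⊢ ◇ i A ⇒ □ i (◇ i A)
  ◇-5 {i} {A} = usub (pq↦ A A) (ax5 i)

  □-mono : ∀ {i A B} → Ax ⊢ A ⇒ B → Ax ⊢ □ i A ⇒ □ i B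
  □-mono {i} d = mp □-K (nec i d)

  ◇-K : ∀ {i A B} → Ax ⊢ □ i (A ⇒ B) ⇒ ◇ i A ⇒ ◇ i B
  ◇-K = ⇒-trans (□-mono ⇒-contrapose) (⇒-trans □-K ⇒-contrapose)

  ◇-mono : ∀ {i A B} → Ax ⊢ A ⇒ B → Ax ⊢ ◇ i A ⇒ ◇ i B
  ◇-mono {i} d = mp ◇-K (nec i d)

  ◇-intro : ∀ {i A} → Ax ⊢ A ⇒ ◇ i A
  ◇-intro = ⇒-trans ¬¬-intro (contrapose □-T)

  ¬◇-intro : ∀ {i A} → Ax ⊢ ¬' A → Ax ⊢ ¬' (◇ i A)
  ¬◇-intro {i} d = mp ¬¬-intro (nec i d)

  □∧□⇒□∧ : ∀ {i A B} → Ax ⊢ □ i A ∧' □ i B ⇒ □ i (A ∧' B)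
  □∧□⇒□∧ = ⇒-uncurry (⇒-trans (□-mono ∧-pair) □-K)

  □∧◇⇒◇∧ : ∀ {i A B} → Ax ⊢ □ i A ∧' ◇ i B ⇒ ◇ i (A ∧' B)
  □∧◇⇒◇∧ = ⇒-uncurry (⇒-trans (□-mono ∧-pair) ◇-K)

  ◇∧□⇒◇∧ : ∀ {i A B} → Ax ⊢ ◇ i A ∧' □ i B ⇒ ◇ i (A ∧' B)
  ◇∧□⇒◇∧ = ⇒-trans ∧-comm (⇒-trans □∧◇⇒◇∧ (◇-mono ∧-comm))

  ◇∧⇒◇∧◇ : ∀ {i A B} → Ax ⊢ ◇ i (A ∧' B) ⇒ ◇ i A ∧' ◇ i B
  ◇∧⇒◇∧◇ = ⇒-∧-intro (◇-mono ∧-elimˡ) (◇-mono ∧-elimʳ)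

  ◇□⇒□ : ∀ {i A} → Ax ⊢ ◇ i (□ i A) ⇒ □ i A
  ◇□⇒□ = ⇒-trans (contrapose (□-mono (contrapose (□-mono ¬¬-intro))))
         (⇒-trans (contrapose ◇-5) (⇒-trans ¬¬-elim (□-mono ¬¬-elim)))

  local⇒□ : ∀ {i A} → Local i A → Ax ⊢ A ⇒ □ i A
  ◇local⇒ : ∀ {i A} → Local i A → Ax ⊢ ◇ i A ⇒ A

  local⇒□ (box ψ) = □-4
  local⇒□ (neg l) = ⇒-trans (contrapose (◇local⇒ l)) ¬¬-elim
  local⇒□ (conj l m) = ⇒-trans (∧-mono (local⇒□ l) (local⇒□ m)) □∧□⇒□∧

  ◇local⇒ (box ψ) = ◇□⇒□
  ◇local⇒ (neg l) = contrapose (⇒-trans (local⇒□ l) (□-mono ¬¬-intro))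
  ◇local⇒ (conj l m) = ⇒-trans ◇∧⇒◇∧◇ (∧-mono (◇local⇒ l) (◇local⇒ m))

  local∧◇⇒◇∧ : ∀ {i A B} → Local i A → Ax ⊢ A ∧' ◇ i B ⇒ ◇ i (A ∧' B)
  local∧◇⇒◇∧ l = ⇒-trans (∧-mono (local⇒□ l) ⇒-refl) □∧◇⇒◇∧

  ◇∧local⇒◇∧ : ∀ {i A B} → Local i B → Ax ⊢ ◇ i A ∧' B ⇒ ◇ i (A ∧' B)
  ◇∧local⇒◇∧ l = ⇒-trans (∧-mono ⇒-refl (local⇒□ l)) ◇∧□⇒◇∧

  ⇒S : ∀ {A} → Ax ⊢ A ⇒ S A
  ⇒S = ⇒-trans ◇-intro ∨-introˡ

  ¬S-intro : ∀ {A} → Ax ⊢ ¬' A → Ax ⊢ ¬' S A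
  ¬S-intro d = ¬∨-intro (¬◇-intro d) (¬◇-intro d)

WD-refute : ∀ {A B} → Local a₁ A → Local a₂ B → WD ⊢ ¬' (A ∧' B) → WD ⊢ ¬' (S A ∧' S B)
WD-refute l₁ l₂ d = modus-tollens (extra (wd l₁ l₂)) (¬S-intro (¬S-intro d))

comm-from-WD : WD ⊢ ◇ a₁ (□ a₂ p) ⇒ □ a₂ (◇ a₁ p)
comm-from-WD = modus-tollens ∧-comm (modus-tollens (∧-mono ∨-introʳ ∨-introˡ) ¬[S□₁¬p∧S□₂p])
  where
  ¬[S□₁¬p∧S□₂p] : WD ⊢ ¬' (S (□ a₁ (¬' p)) ∧' S (□ a₂ p))
  ¬[S□₁¬p∧S□₂p] = WD-refute (box (¬' p)) (box p) (modus-tollens (∧-mono □-T □-T) ¬-contradiction)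

◇₁-of-local₂ : ∀ {A} → Local a₂ A → Comm ⊢ ◇ a₁ A ⇒ □ a₂ (◇ a₁ A)
◇₁-of-local₂ {A} l = ⇒-trans (◇-mono (local⇒□ l)) (usub (pq↦ A A) (extra comm))

wd-from-Comm : ∀ {φ} → WD φ → Comm ⊢ φ
wd-from-Comm (wd {φ₁} {φ₂} l₁ l₂) =
  ⇒-trans (∧-mono (∨-mono (◇local⇒ l₁) ⇒-refl) (∨-mono ⇒-refl (◇local⇒ l₂)))
          (∨∧∨-elim (⇒-trans φ₁∧◇₁φ₂⇒Sχ ⇒S)
                    (⇒-trans ⇒S ⇒S)
                    ◇₂φ₁∧◇₁φ₂⇒SSχ
                    (⇒-trans (◇∧local⇒◇∧ l₂) (⇒-trans ∨-introʳ ⇒S)))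
  where
  χ : Fm
  χ = φ₁ ∧' φ₂

  φ₁∧◇₁φ₂⇒Sχ : Comm ⊢ φ₁ ∧' ◇ a₁ φ₂ ⇒ S χ
  φ₁∧◇₁φ₂⇒Sχ = ⇒-trans (local∧◇⇒◇∧ l₁) ∨-introˡ

  ◇₂φ₁∧◇₁φ₂⇒SSχ : Comm ⊢ ◇ a₂ φ₁ ∧' ◇ a₁ φ₂ ⇒ S (S χ)
  ◇₂φ₁∧◇₁φ₂⇒SSχ = ⇒-trans (∧-mono ⇒-refl (◇₁-of-local₂ l₂))
                  (⇒-trans ◇∧□⇒◇∧ (⇒-trans (◇-mono φ₁∧◇₁φ₂⇒Sχ) ∨-introʳ))

theorem4p2 : ∀ (φ : Fm) → (S5₂⊕ WD φ → S5₂⊕ Comm φ) × (S5₂⊕ Comm φ → S5₂⊕ WD φ)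
theorem4p2 φ = cut-axioms wd-from-Comm , cut-axioms λ { comm → comm-from-WD }
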